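{- Let $G=(V,E)$ be a simple undirected graph with no isolated vertices, with a split partition $(K,I)$ (i.e. $V=K\cup I$ disjointly, $K$ a clique, $I$ an independent set) such that every vertex of $K$ has at least one neighbor in $I$. If $G$ is equimatchable and $|I|\geq 2$, $|K|\geq 2$, then $|K|$ is odd.
   Context: A matching is a set of pairwise vertex-disjoint edges; it is maximal if it is not properly contained in another matching. A graph is equimatchable if all its maximal matchings have the same number of edges. A vertex is isolated if it has no neighbors. -}

module Defs where

open import Data.Nat using (ℕ)
open import Data.Fin using (Fin)
open import Data.Fin.Subset using (Subset; _∈_; _∉_)
open import Data.Product using (Σ; ∃; _×_; _,_; proj₁; proj₂)
open import Data.Sum using (_⊎_)
open import Data.List using (List; length)
open import Data.List.Membership.Propositional renaming (_∈_ to _∈ˡ_)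
open import Data.List.Relation.Unary.AllPairs using (AllPairs)
open import Relation.Nullary using (¬_; Dec)
open import Relation.Binary.PropositionalEquality using (_≡_; _≢_)
open import Level using (0ℓ; suc)

record Graph (n : ℕ) : Set₁ where
  field
    Adj    : Fin n → Fin n → Set
    sym    : ∀ {u v} → Adj u v → Adj v u
    irrefl : ∀ {u} → ¬ Adj u u
    dec    : ∀ u v → Dec (Adj u v)
open Graph public

module _ {n : ℕ} (G : Graph n) where

  -- an edge {u,v} given by one orientation (u , v) together with adjacency
  Edge : Set
  Edge = Σ (Fin n × Fin n) (λ p → Adj G (proj₁ p) (proj₂ p))

  _∈ₑ_ : Fin n → Edge → Set
  v ∈ₑ e = v ≡ proj₁ (proj₁ e) ⊎ v ≡ proj₂ (proj₁ e)

  Disjoint : Edge → Edge → Set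
  Disjoint e f = ∀ v → v ∈ₑ e → ¬ (v ∈ₑ f)

  SameEdge : Edge → Edge → Set
  SameEdge e f = ∀ v → (v ∈ₑ e → v ∈ₑ f) × (v ∈ₑ f → v ∈ₑ e)

  IsMatching : List Edge → Set
  IsMatching M = AllPairs Disjoint M

  _⊆ₘ_ : List Edge → List Edge → Set
  M ⊆ₘ M' = ∀ e → e ∈ˡ M → ∃ λ f → f ∈ˡ M' × SameEdge e f

  IsMaximalMatching : List Edge → Set
  IsMaximalMatching M =
    IsMatching M ×
    (∀ M' → IsMatching M' → M ⊆ₘ M' → M' ⊆ₘ M)

  Equimatchable : Set
  Equimatchable = ∀ M M' → IsMaximalMatching M → IsMaximalMatching M' →
                  length M ≡ length M'

  IsolatedVertex : Fin n → Set
  IsolatedVertex v = ∀ u → ¬ Adj G v u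

  NoIsolatedVertices : Set
  NoIsolatedVertices = ∀ v → ¬ IsolatedVertex v

  -- (K , complement of K) is a split partition: K a clique, V∖K independent
  IsClique : Subset n → Set
  IsClique K = ∀ u v → u ∈ K → v ∈ K → u ≢ v → Adj G u v

  IsIndependent : Subset n → Set
  IsIndependent I = ∀ u v → u ∈ I → v ∈ I → ¬ Adj G u v

-- Since I is independent, K is a vertex cover, so every matching that
-- covers K is maximal.  Suppose ∣ K ∣ = 2k.  Pairing up the clique K gives a
-- maximal matching with k edges.  On the other hand the hypotheses provide two
-- disjoint edges u₁v₁, u₂v₂ with uᵢ ∈ K, vᵢ ∈ I; together with a pairing of the
-- clique K ∖ {u₁, u₂} of size 2(k - 1) they form a maximal matching with k + 1
-- edges, contradicting equimatchability.
module Submission where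

open import Defs
open import Data.Nat using (ℕ; zero; suc; _+_; _≥_; _%_; s≤s; z≤n)
open import Data.Nat.Properties using (+-suc; suc-injective; 1+n≢n; 0≢1+n)
open import Data.Fin using (Fin; zero; suc; _≟_)
open import Data.Fin.Properties using (any?) renaming (suc-injective to fsuc-injective)
open import Data.Fin.Subset using (Subset; _∈_; _∉_; ∣_∣; ∁; _-_; ⁅_⁆; inside; outside)
open import Data.Fin.Subset.Properties
  using (p─⊥≡p; p─q⊆p; x∈p∧x≢y⇒x∈p-y; x∈p⇒x∉∁p; x∉p⇒x∈∁p; _∈?_)
open import Data.Vec using ([]; _∷_)
open import Data.Vec.Base using (here; there)
open import Data.Product using (∃; ∃₂; _×_; _,_; proj₁; proj₂)
open import Data.Sum using (_⊎_; inj₁; inj₂)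
open import Data.List using (List; []; _∷_; length; map)
open import Data.List.Properties using (length-map)
open import Data.List.Membership.Propositional using () renaming (_∈_ to _∈ˡ_)
open import Data.List.Membership.Propositional.Properties using (∈-map⁺; ∈-map⁻)
open import Data.List.Relation.Unary.Any using (here; there)
open import Data.List.Relation.Unary.All as All using (All; []; _∷_)
import Data.List.Relation.Unary.All.Properties as All
open import Data.List.Relation.Unary.AllPairs using (AllPairs; []; _∷_)
import Data.List.Relation.Unary.AllPairs.Properties as AllPairs
open import Relation.Nullary using (¬_; yes; no)
open import Relation.Binary.PropositionalEquality using (_≡_; _≢_; refl; cong; trans; subst)
  renaming (sym to ≡-sym)
open import Data.Empty using (⊥-elim)
open import Function using (_∘_)

enum : ∀ {n} → Subset n → List (Fin n)
enum []            = []
enum (inside  ∷ p) = zero ∷ map suc (enum p)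
enum (outside ∷ p) = map suc (enum p)

length-enum : ∀ {n} (p : Subset n) → length (enum p) ≡ ∣ p ∣
length-enum []            = refl
length-enum (inside  ∷ p) = cong suc (trans (length-map suc (enum p)) (length-enum p))
length-enum (outside ∷ p) = trans (length-map suc (enum p)) (length-enum p)

∈-enum⁺ : ∀ {n} {p : Subset n} {x} → x ∈ p → x ∈ˡ enum p
∈-enum⁺ {p = inside  ∷ p} here        = here refl
∈-enum⁺ {p = inside  ∷ p} (there x∈p) = there (∈-map⁺ suc (∈-enum⁺ x∈p))
∈-enum⁺ {p = outside ∷ p} (there x∈p) = ∈-map⁺ suc (∈-enum⁺ x∈p)

∈-enum⁻ : ∀ {n} {p : Subset n} {x} → x ∈ˡ enum p → x ∈ p
∈-enum⁻ {p = inside  ∷ p} (here refl) = here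
∈-enum⁻ {p = inside  ∷ p} (there x∈) with ∈-map⁻ suc x∈
... | _ , y∈ , refl = there (∈-enum⁻ y∈)
∈-enum⁻ {p = outside ∷ p} x∈ with ∈-map⁻ suc x∈
... | _ , y∈ , refl = there (∈-enum⁻ y∈)

enum-pairwise : ∀ {n} {R : Fin n → Fin n → Set} (p : Subset n) →
  (∀ {x y} → x ∈ p → y ∈ p → x ≢ y → R x y) → AllPairs R (enum p)
enum-pairwise []            R-p = []
enum-pairwise (inside  ∷ p) R-p =
  All.map⁺ (All.tabulate (λ y∈ → R-p here (there (∈-enum⁻ y∈)) (λ ())))
  ∷ AllPairs.map⁺ (enum-pairwise p λ x∈ y∈ x≢y → R-p (there x∈) (there y∈) (x≢y ∘ fsuc-injective))
enum-pairwise (outside ∷ p) R-p =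
  AllPairs.map⁺ (enum-pairwise p λ x∈ y∈ x≢y → R-p (there x∈) (there y∈) (x≢y ∘ fsuc-injective))

∣p-x∣+1≡∣p∣ : ∀ {n} {p : Subset n} {x} → x ∈ p → suc ∣ p - x ∣ ≡ ∣ p ∣
∣p-x∣+1≡∣p∣ {p = inside  ∷ p} {zero}  here        = cong (λ q → suc ∣ q ∣) (p─⊥≡p p)
∣p-x∣+1≡∣p∣ {p = inside  ∷ p} {suc x} (there x∈p) = cong suc (∣p-x∣+1≡∣p∣ x∈p)
∣p-x∣+1≡∣p∣ {p = outside ∷ p} {suc x} (there x∈p) = ∣p-x∣+1≡∣p∣ x∈p

x∈p-y⇒x≢y : ∀ {n} {p : Subset n} {x y} → x ∈ p - y → x ≢ y
x∈p-y⇒x≢y {p = _ ∷ p} {zero}  {suc y} _           = λ ()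
x∈p-y⇒x≢y {p = _ ∷ p} {suc x} {zero}  _           = λ ()
x∈p-y⇒x≢y {p = _ ∷ p} {suc x} {suc y} (there x∈) = λ eq → x∈p-y⇒x≢y x∈ (fsuc-injective eq)

two-members : ∀ {n} (p : Subset n) → ∣ p ∣ ≥ 2 → ∃₂ λ x y → x ∈ p × y ∈ p × x ≢ y
two-members p ∣p∣≥2 = pick (enum p) ∈-enum⁻ (enum-pairwise p (λ _ _ x≢y → x≢y))
                           (subst (_≥ 2) (≡-sym (length-enum p)) ∣p∣≥2)
  where
  pick : ∀ xs → (∀ {x} → x ∈ˡ xs → x ∈ p) → AllPairs _≢_ xs → length xs ≥ 2 →
         ∃₂ λ x y → x ∈ p × y ∈ p × x ≢ y
  pick (x ∷ y ∷ _) ∈p ((x≢y ∷ _) ∷ _) (s≤s (s≤s z≤n)) =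
    x , y , ∈p (here refl) , ∈p (there (here refl)) , x≢y

another-member : ∀ {n} (p : Subset n) → ∣ p ∣ ≥ 2 → ∀ v → ∃ λ w → w ∈ p × w ≢ v
another-member p ∣p∣≥2 v with two-members p ∣p∣≥2
... | x , y , x∈p , y∈p , x≢y with x ≟ v
...   | yes refl = y , y∈p , x≢y ∘ ≡-sym
...   | no  x≢v  = x , x∈p , x≢v

odd-or-double : ∀ m → m % 2 ≡ 1 ⊎ ∃ λ k → m ≡ k + k
odd-or-double zero       = inj₂ (0 , refl)
odd-or-double (suc zero) = inj₁ refl
odd-or-double (suc (suc m)) with odd-or-double m
... | inj₁ odd        = inj₁ odd
... | inj₂ (k , m≡2k) = inj₂ (suc k , trans (cong (λ t → suc (suc t)) m≡2k) (cong suc (≡-sym (+-suc k k))))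

double-pred : ∀ {m} k → suc (suc m) ≡ k + k → ∃ λ j → k ≡ suc j × m ≡ j + j
double-pred (suc j) eq = j , refl , suc-injective (trans (suc-injective eq) (+-suc j j))

allPairs-members : ∀ {A : Set} {R : A → A → Set} {xs a b} →
  AllPairs R xs → a ∈ˡ xs → b ∈ˡ xs → a ≡ b ⊎ R a b ⊎ R b a
allPairs-members (_   ∷ _)   (here refl) (here refl) = inj₁ refl
allPairs-members (R-x ∷ _)   (here refl) (there b∈)  = inj₂ (inj₁ (All.lookup R-x b∈))
allPairs-members (R-x ∷ _)   (there a∈)  (here refl) = inj₂ (inj₂ (All.lookup R-x a∈))
allPairs-members (_   ∷ R-xs) (there a∈) (there b∈)  = allPairs-members R-xs a∈ b∈

module Matchings {n : ℕ} (G : Graph n) where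

  _isEndOf_ : Fin n → Edge G → Set
  z isEndOf e = _∈ₑ_ G z e

  Covers : List (Edge G) → Fin n → Set
  Covers M z = ∃ λ e → e ∈ˡ M × z isEndOf e

  -- Adjacency is decidable, so a vertex that is not isolated has a neighbour.
  neighbour : ∀ v → ¬ IsolatedVertex G v → ∃ λ u → Adj G v u
  neighbour v v-not-isolated with any? (dec G v)
  ... | yes v-has-neighbour = v-has-neighbour
  ... | no  v-isolated      = ⊥-elim (v-not-isolated λ u vu → v-isolated (u , vu))

  avoids⇒disjoint : ∀ {P : Fin n → Set} {e f} →
    (∀ z → z isEndOf e → ¬ P z) → (∀ z → z isEndOf f → P z) → Disjoint G e f
  avoids⇒disjoint e-avoids-P f-within-P z ze zf = e-avoids-P z ze (f-within-P z zf)

  -- Maximality criterion: a matching covering every vertex of a vertex cover C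
  -- is maximal, since every edge of a larger matching meets C in a vertex that
  -- is already matched, hence is one of the old edges.
  covering-matching-is-maximal : (C : Fin n → Set) → (∀ e → ∃ λ z → C z × z isEndOf e) →
    ∀ {M} → IsMatching G M → (∀ z → C z → Covers M z) → IsMaximalMatching G M
  covering-matching-is-maximal C C-covers-edges {M} M-matching M-covers-C =
    M-matching , old-edges
    where
    old-edges : ∀ M' → IsMatching G M' → _⊆ₘ_ G M M' → _⊆ₘ_ G M' M
    old-edges M' M'-matching M⊆M' e e∈M'
      with C-covers-edges e
    ... | z , z∈C , z∈e with M-covers-C z z∈C
    ... | f , f∈M , z∈f with M⊆M' f f∈M
    ... | f' , f'∈M' , f≈f' with allPairs-members M'-matching e∈M' f'∈M'
    ...   | inj₁ refl        = f , f∈M , λ v → proj₂ (f≈f' v) , proj₁ (f≈f' v)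
    ...   | inj₂ (inj₁ e#f') = ⊥-elim (e#f' z z∈e (proj₁ (f≈f' z) z∈f))
    ...   | inj₂ (inj₂ f'#e) = ⊥-elim (f'#e z (proj₁ (f≈f' z) z∈f) z∈e)

  no-larger-maximal-matching : Equimatchable G →
    ¬ (∃₂ λ M M' → IsMaximalMatching G M × IsMaximalMatching G M' × suc (length M) ≡ length M')
  no-larger-maximal-matching equimatchable (M , M' , M-maximal , M'-maximal , 1+∣M∣≡∣M'∣) =
    1+n≢n (trans (cong suc (≡-sym (equimatchable M M' M-maximal M'-maximal))) 1+∣M∣≡∣M'∣)

  record PerfectMatchingOf (S : Fin n → Set) (k : ℕ) : Set where
    field
      edges    : List (Edge G)
      matching : IsMatching G edges
      size     : length edges ≡ k
      covers   : ∀ z → S z → Covers edges z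
      within   : ∀ {e} → e ∈ˡ edges → ∀ z → z isEndOf e → S z
  open PerfectMatchingOf public

  -- A list of 2k pairwise adjacent vertices is perfectly matched by pairing
  -- consecutive entries.
  pair-up : ∀ k xs → AllPairs (Adj G) xs → length xs ≡ k + k → PerfectMatchingOf (_∈ˡ xs) k
  pair-up zero    []          _ _ = record
    { edges = [] ; matching = [] ; size = refl ; covers = λ _ () ; within = λ () }
  pair-up (suc k) (x ∷ [])    _ len = ⊥-elim (0≢1+n (trans (suc-injective len) (+-suc k k)))
  pair-up (suc k) (x ∷ y ∷ r) ((xy ∷ x~r) ∷ y~r ∷ r-clique) len = record
    { edges = xy-edge ∷ edges rest
    ; matching = All.tabulate (λ {f} f∈ → avoids⇒disjoint {e = xy-edge} {f} xy-avoids-r (within rest f∈)) ∷ matching rest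
    ; size = cong suc (size rest)
    ; covers = covered
    ; within = endpoints-in
    }
    where
    rest : PerfectMatchingOf (_∈ˡ r) k
    rest = pair-up k r r-clique (suc-injective (trans (suc-injective len) (+-suc k k)))
    xy-edge : Edge G
    xy-edge = (x , y) , xy
    -- x and y are adjacent to all of r, so by irreflexivity they are not in r
    xy-avoids-r : ∀ z → z isEndOf xy-edge → ¬ z ∈ˡ r
    xy-avoids-r _ (inj₁ refl) x∈r = irrefl G (All.lookup x~r x∈r)
    xy-avoids-r _ (inj₂ refl) y∈r = irrefl G (All.lookup y~r y∈r)
    covered : ∀ z → z ∈ˡ x ∷ y ∷ r → Covers (xy-edge ∷ edges rest) z
    covered _ (here refl)         = xy-edge , here refl , inj₁ refl
    covered _ (there (here refl)) = xy-edge , here refl , inj₂ refl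
    covered z (there (there z∈r)) with covers rest z z∈r
    ... | f , f∈ , z∈f = f , there f∈ , z∈f
    endpoints-in : ∀ {e} → e ∈ˡ xy-edge ∷ edges rest → ∀ z → z isEndOf e → z ∈ˡ x ∷ y ∷ r
    endpoints-in (here refl) _ (inj₁ refl) = here refl
    endpoints-in (here refl) _ (inj₂ refl) = there (here refl)
    endpoints-in (there f∈)  z z∈f         = there (there (within rest f∈ z z∈f))

  clique-matching : ∀ {S} k → IsClique G S → ∣ S ∣ ≡ k + k → PerfectMatchingOf (_∈ S) k
  clique-matching {S} k S-clique ∣S∣≡2k = record
    { edges = edges P ; matching = matching P ; size = size P
    ; covers = λ z z∈S → covers P z (∈-enum⁺ z∈S)
    ; within = λ f∈ z z∈f → ∈-enum⁻ (within P f∈ z z∈f)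
    }
    where
    P = pair-up k (enum S) (enum-pairwise S λ {x} {y} → S-clique x y)
                (trans (length-enum S) ∣S∣≡2k)

module SplitGraph {n : ℕ} (G : Graph n) (K : Subset n)
  (K-clique : IsClique G K) (I-independent : IsIndependent G (∁ K)) where

  open Matchings G

  -- K is a vertex cover: an edge with both ends in the independent set ∁ K cannot exist.
  K-covers-edges : ∀ e → ∃ λ z → z ∈ K × z isEndOf e
  K-covers-edges ((a , b) , ab) with a ∈? K | b ∈? K
  ... | yes a∈K | _       = a , a∈K , inj₁ refl
  ... | no  _   | yes b∈K = b , b∈K , inj₂ refl
  ... | no  a∉K | no  b∉K = ⊥-elim (I-independent a b (x∉p⇒x∈∁p a∉K) (x∉p⇒x∈∁p b∉K) ab)

  neighbour-in-K : ∀ v → v ∈ ∁ K → ¬ IsolatedVertex G v → ∃ λ u → u ∈ K × Adj G u v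
  neighbour-in-K v v∈I v-not-isolated with neighbour v v-not-isolated
  ... | u , vu with u ∈? K
  ...   | yes u∈K = u , u∈K , Graph.sym G vu
  ...   | no  u∉K = ⊥-elim (I-independent v u v∈I (x∉p⇒x∈∁p u∉K) vu)

  record CrossingPair : Set where
    field
      u₁ u₂ v₁ v₂ : Fin n
      u₁∈K : u₁ ∈ K
      u₂∈K : u₂ ∈ K
      v₁∈I : v₁ ∈ ∁ K
      v₂∈I : v₂ ∈ ∁ K
      u₁≢u₂ : u₁ ≢ u₂
      v₁≢v₂ : v₁ ≢ v₂
      u₁v₁ : Adj G u₁ v₁
      u₂v₂ : Adj G u₂ v₂

  -- Take an edge a v₁ with
  -- a ∈ K, and v₂ ∈ I other than v₁, with a neighbour w ∈ K.  If w ≠ a we are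
  -- done; otherwise use b ∈ K other than a and a neighbour y ∈ I of b: pair
  -- b y with a v₁ if y ≠ v₁, and b v₁ with a v₂ if y = v₁.
  crossing-pair : NoIsolatedVertices G → (∀ u → u ∈ K → ∃ λ v → v ∈ ∁ K × Adj G u v) →
    ∣ ∁ K ∣ ≥ 2 → ∣ K ∣ ≥ 2 → CrossingPair
  crossing-pair no-isolated K-to-I ∣I∣≥2 ∣K∣≥2
    with two-members K ∣K∣≥2
  ... | a , b , a∈K , b∈K , a≢b with K-to-I a a∈K
  ... | v₁ , v₁∈I , av₁ with another-member (∁ K) ∣I∣≥2 v₁
  ... | v₂ , v₂∈I , v₂≢v₁ with neighbour-in-K v₂ v₂∈I (no-isolated v₂)
  ... | w , w∈K , wv₂ with w ≟ a
  ...   | no w≢a = record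
    { u₁ = a ; u₂ = w ; v₁ = v₁ ; v₂ = v₂ ; u₁∈K = a∈K ; u₂∈K = w∈K ; v₁∈I = v₁∈I ; v₂∈I = v₂∈I
    ; u₁≢u₂ = w≢a ∘ ≡-sym ; v₁≢v₂ = v₂≢v₁ ∘ ≡-sym ; u₁v₁ = av₁ ; u₂v₂ = wv₂ }
  ...   | yes refl with K-to-I b b∈K
  ...     | y , y∈I , by with y ≟ v₁
  ...       | no y≢v₁ = record
    { u₁ = a ; u₂ = b ; v₁ = v₁ ; v₂ = y ; u₁∈K = a∈K ; u₂∈K = b∈K ; v₁∈I = v₁∈I ; v₂∈I = y∈I
    ; u₁≢u₂ = a≢b ; v₁≢v₂ = y≢v₁ ∘ ≡-sym ; u₁v₁ = av₁ ; u₂v₂ = by }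
  ...       | yes refl = record
    { u₁ = a ; u₂ = b ; v₁ = v₂ ; v₂ = v₁ ; u₁∈K = a∈K ; u₂∈K = b∈K ; v₁∈I = v₂∈I ; v₂∈I = v₁∈I
    ; u₁≢u₂ = a≢b ; v₁≢v₂ = v₂≢v₁ ; u₁v₁ = wv₂ ; u₂v₂ = by }

  covering-K⇒maximal : ∀ {M} → IsMatching G M → (∀ z → z ∈ K → Covers M z) → IsMaximalMatching G M
  covering-K⇒maximal = covering-matching-is-maximal (_∈ K) K-covers-edges

  K≢I : ∀ {x y} → x ∈ K → y ∈ ∁ K → x ≢ y
  K≢I x∈K y∈I refl = x∈p⇒x∉∁p x∈K y∈I

  -- A matching with m edges that covers K; by covering-K⇒maximal it is maximal.
  KCoveringMatching : ℕ → Set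
  KCoveringMatching m =
    ∃ λ M → IsMatching G M × (∀ z → z ∈ K → Covers M z) × length M ≡ m

  pairing-of-K : ∀ k → ∣ K ∣ ≡ k + k → KCoveringMatching k
  pairing-of-K k ∣K∣≡2k = edges P , matching P , covers P , size P
    where
    P : PerfectMatchingOf (_∈ K) k
    P = clique-matching k K-clique ∣K∣≡2k

  module Rerouting (crossing : CrossingPair) where
    open CrossingPair crossing

    K' : Subset n
    K' = K - u₁ - u₂

    K'⊆K : ∀ {z} → z ∈ K' → z ∈ K
    K'⊆K z∈K' = p─q⊆p K ⁅ u₁ ⁆ (p─q⊆p (K - u₁) ⁅ u₂ ⁆ z∈K')

    ∣K'∣+2≡∣K∣ : suc (suc ∣ K' ∣) ≡ ∣ K ∣
    ∣K'∣+2≡∣K∣ = trans (cong suc (∣p-x∣+1≡∣p∣ (x∈p∧x≢y⇒x∈p-y u₂∈K (u₁≢u₂ ∘ ≡-sym))))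
                       (∣p-x∣+1≡∣p∣ u₁∈K)

    e₁ e₂ : Edge G
    e₁ = (u₁ , v₁) , u₁v₁
    e₂ = (u₂ , v₂) , u₂v₂

    -- The crossing edges avoid K', hence every edge of a matching of K'.
    e₁-avoids-K' : ∀ z → z isEndOf e₁ → z ∉ K'
    e₁-avoids-K' _ (inj₁ refl) u₁∈K' = x∈p-y⇒x≢y (p─q⊆p (K - u₁) ⁅ u₂ ⁆ u₁∈K') refl
    e₁-avoids-K' _ (inj₂ refl) v₁∈K' = K≢I (K'⊆K v₁∈K') v₁∈I refl
    e₂-avoids-K' : ∀ z → z isEndOf e₂ → z ∉ K'
    e₂-avoids-K' _ (inj₁ refl) u₂∈K' = x∈p-y⇒x≢y u₂∈K' refl
    e₂-avoids-K' _ (inj₂ refl) v₂∈K' = K≢I (K'⊆K v₂∈K') v₂∈I refl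

    e₁#e₂ : Disjoint G e₁ e₂
    e₁#e₂ _ (inj₁ refl) (inj₁ u₁≡u₂) = u₁≢u₂ u₁≡u₂
    e₁#e₂ _ (inj₁ refl) (inj₂ u₁≡v₂) = K≢I u₁∈K v₂∈I u₁≡v₂
    e₁#e₂ _ (inj₂ refl) (inj₁ v₁≡u₂) = K≢I u₂∈K v₁∈I (≡-sym v₁≡u₂)
    e₁#e₂ _ (inj₂ refl) (inj₂ v₁≡v₂) = v₁≢v₂ v₁≡v₂

    rerouted-matching : ∀ j → ∣ K' ∣ ≡ j + j → KCoveringMatching (suc (suc j))
    rerouted-matching j ∣K'∣≡2j =
      e₁ ∷ e₂ ∷ edges P' , M'-matching , M'-covers , cong (λ t → suc (suc t)) (size P')
      where
      P' : PerfectMatchingOf (_∈ K') j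
      P' = clique-matching j (λ x y x∈ y∈ → K-clique x y (K'⊆K x∈) (K'⊆K y∈)) ∣K'∣≡2j
      M'-matching : IsMatching G (e₁ ∷ e₂ ∷ edges P')
      M'-matching =
        (e₁#e₂ ∷ All.tabulate (λ {f} f∈ → avoids⇒disjoint {e = e₁} {f} e₁-avoids-K' (within P' f∈)))
        ∷ All.tabulate (λ {f} f∈ → avoids⇒disjoint {e = e₂} {f} e₂-avoids-K' (within P' f∈))
        ∷ matching P'
      M'-covers : ∀ z → z ∈ K → Covers (e₁ ∷ e₂ ∷ edges P') z
      M'-covers z z∈K with z ≟ u₁ | z ≟ u₂
      ... | yes refl | _        = e₁ , here refl , inj₁ refl
      ... | no  _    | yes refl = e₂ , there (here refl) , inj₁ refl
      ... | no  z≢u₁ | no  z≢u₂ with covers P' z (x∈p∧x≢y⇒x∈p-y (x∈p∧x≢y⇒x∈p-y z∈K z≢u₁) z≢u₂)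
      ...   | f , f∈ , z∈f = f , there (there f∈) , z∈f

  unequal-maximal-matchings : CrossingPair → ∀ k → ∣ K ∣ ≡ k + k →
    ∃₂ λ M M' → IsMaximalMatching G M × IsMaximalMatching G M' × suc (length M) ≡ length M'
  unequal-maximal-matchings crossing k ∣K∣≡2k =
    let (j , k≡1+j , ∣K'∣≡2j) = double-pred k (trans ∣K'∣+2≡∣K∣ ∣K∣≡2k)
        (M , M-matching , M-covers , ∣M∣≡k) = pairing-of-K k ∣K∣≡2k
        (M' , M'-matching , M'-covers , ∣M'∣≡2+j) = rerouted-matching j ∣K'∣≡2j
    in M , M' , covering-K⇒maximal M-matching M-covers , covering-K⇒maximal M'-matching M'-covers
       , trans (cong suc (trans ∣M∣≡k k≡1+j)) (≡-sym ∣M'∣≡2+j)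
    where open Rerouting crossing

lemma2p3 : ∀ {n : ℕ} (G : Graph n) (K : Subset n) →
    NoIsolatedVertices G →
    IsClique G K →
    IsIndependent G (∁ K) →
    (∀ u → u ∈ K → ∃ λ v → v ∈ ∁ K × Adj G u v) →
    Equimatchable G →
    ∣ ∁ K ∣ ≥ 2 →
    ∣ K ∣ ≥ 2 →
    ∣ K ∣ % 2 ≡ 1
lemma2p3 G K no-isolated K-clique I-independent K-to-I equimatchable ∣I∣≥2 ∣K∣≥2
  with odd-or-double ∣ K ∣
... | inj₁ ∣K∣-odd        = ∣K∣-odd
... | inj₂ (k , ∣K∣≡2k) = ⊥-elim (no-larger-maximal-matching equimatchable
    (unequal-maximal-matchings (crossing-pair no-isolated K-to-I ∣I∣≥2 ∣K∣≥2) k ∣K∣≡2k))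
  where
  open Matchings G
  open SplitGraph G K K-clique I-independent
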